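{- Let $M=p_i^{n_i}p_j^{n_j}p_k^{n_k}$ with distinct primes, and let $A,B\subset\mathbb{Z}_M$ with $A\oplus B=\mathbb{Z}_M$, $|A|=p_ip_jp_k$, $\Phi_M\mid A$, and such that for every $a\in A$ the set $A\cap\Lambda(a,D(M))$ is $M$-fibered in at least one of the three directions. Assume $\mathcal{I}\cap\mathcal{J}\cap\mathcal{K}=\emptyset$ and $\{m:D(M)\mid m\mid M\}\cap{\mathrm{Div}}(B)=\{M\}$. Then at least one of $\mathcal{I},\mathcal{J},\mathcal{K}$ is empty.
   Context: $A\oplus B=\mathbb{Z}_M$: every element of $\mathbb{Z}_M$ is uniquely $a+b$. "$\Phi_M\mid A$": the $M$-th cyclotomic polynomial divides $\sum_{a\in A}X^a$. $(x,m)$ for $x\in\mathbb{Z}_M$, $m\mid M$ is the gcd of $m$ with a representative of $x$; ${\mathrm{Div}}(B)=\{(b-b',M):b,b'\in B\}$. $D(M)=p_i^{n_i-1}p_j^{n_j-1}p_k^{n_k-1}$, $\Lambda(x,D)=\{x':D\mid x-x'\}$. $F_\nu=\{tM/p_\nu:0\le t<p_\nu\}$, $x*F_\nu=x+F_\nu$; a set $S$ is $M$-fibered in the $p_\nu$ direction if $x\in S\Rightarrow x*F_\nu\subset S$. $\mathcal{I}=\{a\in A:a*F_i\subset A\}$, $\mathcal{J}=\{a\in A:a*F_j\subset A\}$, $\mathcal{K}=\{a\in A:a*F_k\subset A\}$. -}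

module Defs where

open import Data.Nat as ℕ using (ℕ; zero; suc; _∸_; _^_; _<_)
open import Data.Nat.GCD using (gcd)
open import Data.Integer as ℤ using (ℤ; +_; -[1+_]; ∣_∣)
open import Data.Integer.Divisibility as ℤD using ()
open import Data.Fin using (Fin; toℕ)
open import Data.Fin.Subset using (Subset; _∈_)
open import Data.Bool using (Bool; true; false; if_then_else_)
open import Data.List using (List; []; _∷_; map; replicate; _∷ʳ_)
open import Data.Vec using (toList)
import Data.Vec as Vec
open import Data.Product using (Σ; _×_; _,_; ∃; ∃-syntax)
open import Relation.Binary.PropositionalEquality using (_≡_)

-- Residues and congruences.  Z_M is represented by Fin M (the residue
-- x is identified with its representative toℕ x ∈ [0, M)).

ModEq : ℕ → ℕ → ℕ → Set
ModEq m x y = (+ m) ℤD.∣ ((+ x) ℤ.- (+ y))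

IsSumOf : (M : ℕ) → Subset M → Subset M → Fin M → Fin M → Fin M → Set
IsSumOf M A B x a b = a ∈ A × b ∈ B × ModEq M (toℕ a ℕ.+ toℕ b) (toℕ x)

Tiling : (M : ℕ) → Subset M → Subset M → Set
Tiling M A B = ∀ (x : Fin M) →
  Σ (Fin M) λ a → Σ (Fin M) λ b → IsSumOf M A B x a b ×
    (∀ a' b' → IsSumOf M A B x a' b' → a' ≡ a × b' ≡ b)

-- Integer polynomials as coefficient lists (constant term first).

Poly : Set
Poly = List ℤ

coeff : Poly → ℕ → ℤ
coeff []      _       = + 0
coeff (c ∷ _) zero    = c
coeff (_ ∷ p) (suc n) = coeff p n

-- equality of polynomials (trailing zeros irrelevant)
_≈P_ : Poly → Poly → Set
p ≈P q = ∀ n → coeff p n ≡ coeff q n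

_+P_ : Poly → Poly → Poly
[]      +P q       = q
(x ∷ p) +P []      = x ∷ p
(x ∷ p) +P (y ∷ q) = (x ℤ.+ y) ∷ (p +P q)

_*P_ : Poly → Poly → Poly
[]      *P q = []
(x ∷ p) *P q = map (x ℤ.*_) q +P (+ 0 ∷ (p *P q))

monomial : ℕ → Poly
monomial d = replicate d (+ 0) ∷ʳ (+ 1)

Xm1 : ℕ → Poly
Xm1 d = monomial d +P (-[1+ 0 ] ∷ [])

mask : ∀ {M} → Subset M → Poly
mask A = toList (Vec.map (λ b → if b then + 1 else + 0) A)

-- By the Möbius product formula
--   Φ_M(X) = Num(X) / Den(X),
--   Num = (X^M -1)(X^{M/pq} -1)(X^{M/pr} -1)(X^{M/qr} -1),
--   Den = (X^{M/p} -1)(X^{M/q} -1)(X^{M/r} -1)(X^{M/pqr} -1).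
-- Φ_M ∣ F(X) in ℤ[X] (equivalently ℚ[X], Φ_M being monic) iff there is
-- Q ∈ ℤ[X] with F = Φ_M · Q, i.e. Den · F = Num · Q.

PhiDivides : (p q r a b c : ℕ) → Poly → Set
PhiDivides p q r a b c F = ∃[ Q ] ((Den *P F) ≈P (Num *P Q))
  where
  Num Den : Poly
  Num = Xm1 (p ^ a ℕ.* q ^ b ℕ.* r ^ c)
     *P (Xm1 (p ^ (a ∸ 1) ℕ.* q ^ (b ∸ 1) ℕ.* r ^ c)
     *P (Xm1 (p ^ (a ∸ 1) ℕ.* q ^ b ℕ.* r ^ (c ∸ 1))
     *P  Xm1 (p ^ a ℕ.* q ^ (b ∸ 1) ℕ.* r ^ (c ∸ 1))))
  Den = Xm1 (p ^ (a ∸ 1) ℕ.* q ^ b ℕ.* r ^ c)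
     *P (Xm1 (p ^ a ℕ.* q ^ (b ∸ 1) ℕ.* r ^ c)
     *P (Xm1 (p ^ a ℕ.* q ^ b ℕ.* r ^ (c ∸ 1))
     *P  Xm1 (p ^ (a ∸ 1) ℕ.* q ^ (b ∸ 1) ℕ.* r ^ (c ∸ 1))))

-- Fibers.  F_ν = {t·(M/p_ν) : 0 ≤ t < p_ν};  x * F_ν = x + F_ν.
-- `step` is M/p_ν and `pν` is p_ν.

InFiber : (M step pν : ℕ) → Fin M → Fin M → Set
InFiber M step pν x y = ∃[ t ] (t < pν × ModEq M (toℕ x ℕ.+ t ℕ.* step) (toℕ y))

FiberIn : (M step pν : ℕ) → (Fin M → Set) → Fin M → Set
FiberIn M step pν S x = ∀ y → InFiber M step pν x y → S y

Fibered : (M step pν : ℕ) → (Fin M → Set) → Set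
Fibered M step pν S = ∀ x → S x → FiberIn M step pν S x

Λ : (M D : ℕ) → Fin M → Fin M → Set
Λ M D x x' = ModEq D (toℕ x) (toℕ x')

AΛ : (M D : ℕ) → Subset M → Fin M → Fin M → Set
AΛ M D A a x = x ∈ A × Λ M D a x

-- the sets I, J, K: { a ∈ A : a * F_ν ⊂ A }
FibPart : (M step pν : ℕ) → Subset M → Fin M → Set
FibPart M step pν A a = a ∈ A × FiberIn M step pν (λ y → y ∈ A) a

InDiv : (M : ℕ) → Subset M → ℕ → Set
InDiv M B m = Σ (Fin M) λ b → Σ (Fin M) λ b' →
  b ∈ B × b' ∈ B × gcd ∣ (+ toℕ b) ℤ.- (+ toℕ b') ∣ M ≡ m

{-# OPTIONS --safe #-}
-- Write x ∈ ℤ_M as x = a(x) + b(x) with a(x) ∈ A, b(x) ∈ B.  Then a(x) ∈ 𝓘 exactly when b is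
-- constant on x * F_i (likewise for 𝓙, 𝓚), and A ∩ Λ(a(x), D) being fibered in direction l says
-- that b is constant along l through every y ≡ x (mod D) with b(y) = b(x).  Elements of B are
-- incongruent mod D, so a is injective on the subgroup D·ℤ_M = {Σ_ν c_ν M/p_ν : 0 ≤ c_ν < p_ν};
-- as |A| = p_i p_j p_k, every element of A is a(x) for such a grid point x.  If b is constant
-- along l through a grid point by fiberedness and also along some μ ≠ l, it is constant on the
-- whole (l, μ)-plane, which meets every line in the third direction ν.  So if 𝓘, 𝓙 and 𝓚 were
-- all nonempty, the ν-line through a grid point representing an element of the ν-th set would
-- meet that plane in a point x with a(x) ∈ 𝓘 ∩ 𝓙 ∩ 𝓚; a grid point assembled cyclically from
-- such representatives provides the required l and μ.
module Submission where

open import Defs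
open import Data.Nat using (ℕ; _^_; _*_; _∸_; _≤_)
open import Data.Nat.Divisibility using (_∣_)
open import Data.Nat.Primality using (Prime)
open import Data.Fin using (Fin)
open import Data.Fin.Subset using (Subset; ∣_∣; _∈_)
open import Data.Product using (_×_)
open import Data.Sum using (_⊎_)
open import Data.Empty using (⊥)
open import Relation.Nullary using (¬_)
open import Relation.Binary.PropositionalEquality using (_≡_)

open import Data.Nat using (suc; pred; _+_; _<_; z≤n; s≤s; NonZero; ≢-nonZero; ≢-nonZero⁻¹)
import Data.Nat.Properties as ℕP
open import Data.Nat.DivMod using (_%_; _/_; _mod_; m≡m%n+[m/n]*n; m%n<n)
open import Data.Nat.Divisibility as ℕ∣ using (divides; ∣m∣n⇒∣m+n; ∣n⇒∣m*n; n∣m*n; m∣m*n)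
open import Data.Nat.GCD using (gcd; gcd[m,n]∣m; gcd[m,n]∣n; gcd-greatest)
open import Data.Nat.Primality using (euclidsLemma; prime⇒irreducible; prime⇒nonZero; ¬prime[1])
import Data.Nat.Tactic.RingSolver as ℕ-Solver
open import Data.Integer as ℤ using (+_)
import Data.Integer.Properties as ℤP
open import Data.Integer.Divisibility.Signed as ℤ∣ using (∣ᵤ⇒∣; ∣⇒∣ᵤ) renaming (_∣_ to _∣ℤ_)
import Data.Integer.Tactic.RingSolver as ℤ-Solver
open import Data.Fin using (zero; suc; toℕ; fromℕ<; remQuot; combine)
open import Data.Fin.Properties as FinP using (toℕ<n; toℕ-injective; toℕ-fromℕ<; combine-remQuot)
open import Data.Fin.Subset using (_-_)
open import Data.Fin.Subset.Properties using (_∈?_; x∈p⇒∣p-x∣<∣p∣; x∈p∧x≢y⇒x∈p-y)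
open import Data.Product using (∃; ∃-syntax; _,_; proj₁; proj₂; map₂; curry)
open import Data.Sum using (inj₁; inj₂)
open import Function using (_∘_; _∘₂_; _$_)
open import Function.Definitions using (Injective)
open import Relation.Nullary using (Dec; yes; no; contradiction)
open import Relation.Nullary.Decidable using (map′; _×-dec_)
open import Relation.Binary using (Setoid; DecidableEquality)
import Relation.Binary.Reasoning.Setoid as SetoidReasoning
open import Relation.Binary.PropositionalEquality
  using (_≢_; refl; sym; trans; cong; cong₂; subst; subst₂; module ≡-Reasoning)

infix 4 _≡_[mod_]

-- Signed divisibility of x − y in ℤ, wrapped in a record so that x, y and m can be inferred.
record _≡_[mod_] (x y m : ℕ) : Set where
  constructor ≡mod
  field ∣difference : + m ∣ℤ + x ℤ.- + y

ModEq⇒≡mod : ∀ {m x y} → ModEq m x y → x ≡ y [mod m ]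
ModEq⇒≡mod = ≡mod ∘ ∣ᵤ⇒∣

≡mod⇒ModEq : ∀ {m x y} → x ≡ y [mod m ] → ModEq m x y
≡mod⇒ModEq = ∣⇒∣ᵤ ∘ _≡_[mod_].∣difference

difference-+ : ∀ x y u v → + (x + u) ℤ.- + (y + v) ≡ (+ x ℤ.- + y) ℤ.+ (+ u ℤ.- + v)
difference-+ x y u v = trans (cong₂ ℤ._-_ (ℤP.pos-+ x u) (ℤP.pos-+ y v)) (regroup (+ x) (+ y) (+ u) (+ v))
  where
  regroup : ∀ a b c d → (a ℤ.+ c) ℤ.- (b ℤ.+ d) ≡ (a ℤ.- b) ℤ.+ (c ℤ.- d)
  regroup = ℤ-Solver.solve-∀

difference-* : ∀ x y d → + (x * d) ℤ.- + (y * d) ≡ (+ x ℤ.- + y) ℤ.* + d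
difference-* x y d = trans (cong₂ ℤ._-_ (ℤP.pos-* x d) (ℤP.pos-* y d)) (factor (+ x) (+ y) (+ d))
  where
  factor : ∀ a b c → a ℤ.* c ℤ.- b ℤ.* c ≡ (a ℤ.- b) ℤ.* c
  factor = ℤ-Solver.solve-∀

module _ {m : ℕ} where

  ≡mod-refl : ∀ {x} → x ≡ x [mod m ]
  ≡mod-refl {x} = ≡mod (ℤ∣.divides (+ 0) (ℤP.+-inverseʳ (+ x)))

  ≡mod-sym : ∀ {x y} → x ≡ y [mod m ] → y ≡ x [mod m ]
  ≡mod-sym {x} {y} (≡mod m∣x-y) = ≡mod (subst (+ m ∣ℤ_) (negate (+ x) (+ y)) (ℤ∣.∣m⇒∣-m m∣x-y))
    where
    negate : ∀ a b → ℤ.- (a ℤ.- b) ≡ b ℤ.- a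
    negate = ℤ-Solver.solve-∀

  ≡mod-trans : ∀ {x y z} → x ≡ y [mod m ] → y ≡ z [mod m ] → x ≡ z [mod m ]
  ≡mod-trans {x} {y} {z} (≡mod m∣x-y) (≡mod m∣y-z) =
    ≡mod (subst (+ m ∣ℤ_) (telescope (+ x) (+ y) (+ z)) (ℤ∣.∣m∣n⇒∣m+n m∣x-y m∣y-z))
    where
    telescope : ∀ a b c → (a ℤ.- b) ℤ.+ (b ℤ.- c) ≡ a ℤ.- c
    telescope = ℤ-Solver.solve-∀

  ≡mod-setoid : Setoid _ _
  ≡mod-setoid = record
    { Carrier       = ℕ
    ; _≈_           = λ x y → x ≡ y [mod m ]
    ; isEquivalence = record { refl = ≡mod-refl ; sym = ≡mod-sym ; trans = ≡mod-trans }
    }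

  ≡mod-+ : ∀ {x y u v} → x ≡ y [mod m ] → u ≡ v [mod m ] → x + u ≡ y + v [mod m ]
  ≡mod-+ {x} {y} {u} {v} (≡mod m∣x-y) (≡mod m∣u-v) =
    ≡mod (subst (+ m ∣ℤ_) (sym (difference-+ x y u v)) (ℤ∣.∣m∣n⇒∣m+n m∣x-y m∣u-v))

  ≡mod-+-cancelʳ : ∀ {x y} z → x + z ≡ y + z [mod m ] → x ≡ y [mod m ]
  ≡mod-+-cancelʳ {x} {y} z (≡mod m∣difference) = ≡mod (subst (+ m ∣ℤ_) cancel m∣difference)
    where
    cancel : + (x + z) ℤ.- + (y + z) ≡ + x ℤ.- + y
    cancel = trans (difference-+ x y z z)
      (trans (cong (λ w → (+ x ℤ.- + y) ℤ.+ w) (ℤP.+-inverseʳ (+ z))) (ℤP.+-identityʳ _))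

  ≡mod-+-cancelˡ : ∀ {x y} z → z + x ≡ z + y [mod m ] → x ≡ y [mod m ]
  ≡mod-+-cancelˡ {x} {y} z =
    ≡mod-+-cancelʳ z ∘ subst₂ (λ u v → u ≡ v [mod m ]) (ℕP.+-comm z x) (ℕP.+-comm z y)

  ∣⇒≡mod0 : ∀ {n} → m ∣ n → n ≡ 0 [mod m ]
  ∣⇒≡mod0 {n} (divides q n≡q*m) =
    ≡mod (ℤ∣.divides (+ q) (trans (ℤP.+-identityʳ (+ n)) (trans (cong +_ n≡q*m) (ℤP.pos-* q m))))

  +-∣-≡mod : ∀ x {n} → m ∣ n → x + n ≡ x [mod m ]
  +-∣-≡mod x m∣n =
    subst (λ y → x + _ ≡ y [mod m ]) (ℕP.+-identityʳ x) (≡mod-+ (≡mod-refl {x}) (∣⇒≡mod0 m∣n))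

  ≡mod⇒≡ : ∀ {x y} → x < m → y < m → x ≡ y [mod m ] → x ≡ y
  ≡mod⇒≡ {x} {y} x<m y<m x≡y =
    ℤP.+-injective (ℤP.i-j≡0⇒i≡j (+ x) (+ y) (ℤP.∣i∣≡0⇒i≡0 (small-multiple (≡mod⇒ModEq x≡y))))
    where
    |x-y|<m : ℤ.∣ + x ℤ.- + y ∣ < m
    |x-y|<m = ℕP.≤-<-trans (ℕP.≤-reflexive (cong ℤ.∣_∣ (ℤP.[+m]-[+n]≡m⊖n x y)))
                (ℕP.≤-<-trans (ℤP.∣m⊝n∣≤m⊔n x y) (ℕP.⊔-lub x<m y<m))
    small-multiple : m ∣ ℤ.∣ + x ℤ.- + y ∣ → ℤ.∣ + x ℤ.- + y ∣ ≡ 0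
    small-multiple m∣ with ℤ.∣ + x ℤ.- + y ∣ in eq
    ... | 0     = refl
    ... | suc r = contradiction (ℕ∣.∣⇒≤ m∣) (ℕP.<⇒≱ (subst (_< m) eq |x-y|<m))

≡mod-∣ : ∀ {d m x y} → d ∣ m → x ≡ y [mod m ] → x ≡ y [mod d ]
≡mod-∣ {d} {m} d∣m (≡mod m∣x-y) = ≡mod (ℤ∣.∣-trans (∣ᵤ⇒∣ {+ d} {+ m} d∣m) m∣x-y)

*-cancelʳ-≡mod : ∀ {p x y} d .{{_ : NonZero d}} → x * d ≡ y * d [mod p * d ] → x ≡ y [mod p ]
*-cancelʳ-≡mod {p} {x} {y} d (≡mod pd∣xd-yd) =
  ≡mod (ℤ∣.*-cancelʳ-∣ (+ d) (subst₂ _∣ℤ_ (ℤP.pos-* p d) (difference-* x y d) pd∣xd-yd))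

prime-*-cancelʳ-≡mod : ∀ {p e x y} → Prime p → ¬ p ∣ e → x * e ≡ y * e [mod p ] → x ≡ y [mod p ]
prime-*-cancelʳ-≡mod {p} {e} {x} {y} p-prime p∤e (≡mod p∣xe-ye) with euclidsLemma _ e p-prime p∣|x-y|*e
  where
  p∣|x-y|*e : p ∣ ℤ.∣ + x ℤ.- + y ∣ * e
  p∣|x-y|*e = subst (p ∣_) (ℤP.abs-* (+ x ℤ.- + y) (+ e))
    (∣⇒∣ᵤ (subst (+ p ∣ℤ_) (difference-* x y e) p∣xe-ye))
... | inj₁ p∣|x-y| = ≡mod (∣ᵤ⇒∣ p∣|x-y|)
... | inj₂ p∣e     = contradiction p∣e p∤e

data Dir : Set where
  dᵢ dⱼ dₖ : Dir

_≟_ : DecidableEquality Dir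
dᵢ ≟ dᵢ = yes refl
dᵢ ≟ dⱼ = no λ ()
dᵢ ≟ dₖ = no λ ()
dⱼ ≟ dᵢ = no λ ()
dⱼ ≟ dⱼ = yes refl
dⱼ ≟ dₖ = no λ ()
dₖ ≟ dᵢ = no λ ()
dₖ ≟ dⱼ = no λ ()
dₖ ≟ dₖ = yes refl

next prev : Dir → Dir
next dᵢ = dⱼ
next dⱼ = dₖ
next dₖ = dᵢ
prev dᵢ = dₖ
prev dⱼ = dᵢ
prev dₖ = dⱼ

next≢ : ∀ δ → next δ ≢ δ
next≢ dᵢ ()
next≢ dⱼ ()
next≢ dₖ ()

prev≢ : ∀ δ → prev δ ≢ δ
prev≢ dᵢ ()
prev≢ dⱼ ()
prev≢ dₖ ()

complement : ∀ {a b : Dir} → a ≢ b → ∃[ d ] (∀ δ → δ ≡ a ⊎ δ ≡ b ⊎ δ ≡ d)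
complement {dᵢ} {dᵢ} a≢b = contradiction refl a≢b
complement {dⱼ} {dⱼ} a≢b = contradiction refl a≢b
complement {dₖ} {dₖ} a≢b = contradiction refl a≢b
complement {dᵢ} {dⱼ} _ = dₖ , λ { dᵢ → inj₁ refl ; dⱼ → inj₂ (inj₁ refl) ; dₖ → inj₂ (inj₂ refl) }
complement {dⱼ} {dᵢ} _ = dₖ , λ { dᵢ → inj₂ (inj₁ refl) ; dⱼ → inj₁ refl ; dₖ → inj₂ (inj₂ refl) }
complement {dᵢ} {dₖ} _ = dⱼ , λ { dᵢ → inj₁ refl ; dⱼ → inj₂ (inj₂ refl) ; dₖ → inj₂ (inj₁ refl) }
complement {dₖ} {dᵢ} _ = dⱼ , λ { dᵢ → inj₂ (inj₁ refl) ; dⱼ → inj₂ (inj₂ refl) ; dₖ → inj₁ refl }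
complement {dⱼ} {dₖ} _ = dᵢ , λ { dᵢ → inj₂ (inj₂ refl) ; dⱼ → inj₁ refl ; dₖ → inj₂ (inj₁ refl) }
complement {dₖ} {dⱼ} _ = dᵢ , λ { dᵢ → inj₂ (inj₂ refl) ; dⱼ → inj₂ (inj₁ refl) ; dₖ → inj₁ refl }

¬∀⇒∃¬ : ∀ {P : Dir → Set} → (∀ δ → Dec (P δ)) → ¬ (∀ δ → P δ) → ∃[ δ ] ¬ P δ
¬∀⇒∃¬ P? ¬∀P with P? dᵢ | P? dⱼ | P? dₖ
... | no ¬Pᵢ | _      | _      = dᵢ , ¬Pᵢ
... | yes _  | no ¬Pⱼ | _      = dⱼ , ¬Pⱼ
... | yes _  | yes _  | no ¬Pₖ = dₖ , ¬Pₖ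
... | yes Pᵢ | yes Pⱼ | yes Pₖ = contradiction (λ { dᵢ → Pᵢ ; dⱼ → Pⱼ ; dₖ → Pₖ }) ¬∀P

∃⇒⊎₃ : ∀ {P : Dir → Set} → ∃ P → P dᵢ ⊎ P dⱼ ⊎ P dₖ
∃⇒⊎₃ (dᵢ , Pᵢ) = inj₁ Pᵢ
∃⇒⊎₃ (dⱼ , Pⱼ) = inj₂ (inj₁ Pⱼ)
∃⇒⊎₃ (dₖ , Pₖ) = inj₂ (inj₂ Pₖ)

⊎₃⇒∃ : ∀ {P : Dir → Set} → P dᵢ ⊎ P dⱼ ⊎ P dₖ → ∃ P
⊎₃⇒∃ (inj₁ Pᵢ)        = dᵢ , Pᵢ
⊎₃⇒∃ (inj₂ (inj₁ Pⱼ)) = dⱼ , Pⱼ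
⊎₃⇒∃ (inj₂ (inj₂ Pₖ)) = dₖ , Pₖ

⟨_,_,_⟩ : ∀ {A : Set} → A → A → A → Dir → A
⟨ x , y , z ⟩ dᵢ = x
⟨ x , y , z ⟩ dⱼ = y
⟨ x , y , z ⟩ dₖ = z

⟨,,⟩-distinct : ∀ {A : Set} {x y z : A} → x ≢ y → x ≢ z → y ≢ z →
                ∀ {δ δ′} → δ ≢ δ′ → ⟨ x , y , z ⟩ δ ≢ ⟨ x , y , z ⟩ δ′
⟨,,⟩-distinct x≢y x≢z y≢z {dᵢ} {dᵢ} i≢i = contradiction refl i≢i
⟨,,⟩-distinct x≢y x≢z y≢z {dᵢ} {dⱼ} _   = x≢y
⟨,,⟩-distinct x≢y x≢z y≢z {dᵢ} {dₖ} _   = x≢z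
⟨,,⟩-distinct x≢y x≢z y≢z {dⱼ} {dᵢ} _   = x≢y ∘ sym
⟨,,⟩-distinct x≢y x≢z y≢z {dⱼ} {dⱼ} j≢j = contradiction refl j≢j
⟨,,⟩-distinct x≢y x≢z y≢z {dⱼ} {dₖ} _   = y≢z
⟨,,⟩-distinct x≢y x≢z y≢z {dₖ} {dᵢ} _   = x≢z ∘ sym
⟨,,⟩-distinct x≢y x≢z y≢z {dₖ} {dⱼ} _   = y≢z ∘ sym
⟨,,⟩-distinct x≢y x≢z y≢z {dₖ} {dₖ} k≢k = contradiction refl k≢k

⟨,,⟩-all : ∀ {A : Set} (P : A → Set) {x y z} → P x → P y → P z → ∀ δ → P (⟨ x , y , z ⟩ δ)
⟨,,⟩-all P Px Py Pz dᵢ = Px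
⟨,,⟩-all P Px Py Pz dⱼ = Py
⟨,,⟩-all P Px Py Pz dₖ = Pz

∑ ∏ : (Dir → ℕ) → ℕ
∑ f = f dᵢ + f dⱼ + f dₖ
∏ f = f dᵢ * f dⱼ * f dₖ

∏-nonZero : ∀ {f} → (∀ δ → NonZero (f δ)) → NonZero (∏ f)
∏-nonZero f≢0 = ℕP.m*n≢0 _ _ {{ℕP.m*n≢0 _ _ {{f≢0 dᵢ}} {{f≢0 dⱼ}}}} {{f≢0 dₖ}}

∑-rotate : ∀ δ f → ∑ f ≡ f δ + (f (next δ) + f (prev δ))
∑-rotate dᵢ f = ℕP.+-assoc (f dᵢ) (f dⱼ) (f dₖ)
∑-rotate dⱼ f = rotateⱼ (f dᵢ) (f dⱼ) (f dₖ)
  where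
  rotateⱼ : ∀ a b c → a + b + c ≡ b + (c + a)
  rotateⱼ = ℕ-Solver.solve-∀
∑-rotate dₖ f = rotateₖ (f dᵢ) (f dⱼ) (f dₖ)
  where
  rotateₖ : ∀ a b c → a + b + c ≡ c + (a + b)
  rotateₖ = ℕ-Solver.solve-∀

∑-∣ : ∀ {d f} → (∀ δ → d ∣ f δ) → d ∣ ∑ f
∑-∣ d∣f = ∣m∣n⇒∣m+n (∣m∣n⇒∣m+n (d∣f dᵢ) (d∣f dⱼ)) (d∣f dₖ)

module _ {X : Set} where

  infixl 9 _[_]≔_
  infix 4 _≈[_]_

  _[_]≔_ : (Dir → X) → Dir → X → (Dir → X)
  (c [ δ ]≔ v) δ′ with δ′ ≟ δ
  ... | yes _ = v
  ... | no _  = c δ′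

  []≔-updates : ∀ c δ v → (c [ δ ]≔ v) δ ≡ v
  []≔-updates c δ v with δ ≟ δ
  ... | yes _  = refl
  ... | no δ≢δ = contradiction refl δ≢δ

  []≔-minimal : ∀ c {δ δ′} v → δ′ ≢ δ → (c [ δ ]≔ v) δ′ ≡ c δ′
  []≔-minimal c {δ} {δ′} v δ′≢δ with δ′ ≟ δ
  ... | yes δ′≡δ = contradiction δ′≡δ δ′≢δ
  ... | no _     = refl

  _≈[_]_ : (Dir → X) → Dir → (Dir → X) → Set
  c ≈[ δ ] c′ = ∀ δ′ → δ′ ≢ δ → c δ′ ≡ c′ δ′

  ≈-[]≔ : ∀ c δ v → c ≈[ δ ] c [ δ ]≔ v
  ≈-[]≔ c δ v δ′ δ′≢δ = sym ([]≔-minimal c v δ′≢δ)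

position : (st c : Dir → ℕ) → ℕ
position st c = ∑ λ δ → c δ * st δ

position-≈ : ∀ st {c c′ δ} → c ≈[ δ ] c′ → position st c + c′ δ * st δ ≡ position st c′ + c δ * st δ
position-≈ st {c} {c′} {δ} c≈c′ = begin
  position st c + c′ δ * st δ        ≡⟨ cong (_+ c′ δ * st δ) (∑-rotate δ (term c)) ⟩
  c δ * st δ + rest c + c′ δ * st δ  ≡⟨ cong (λ r → c δ * st δ + r + c′ δ * st δ) rest-agrees ⟩
  c δ * st δ + rest c′ + c′ δ * st δ ≡⟨ swap-outer (c δ * st δ) (rest c′) (c′ δ * st δ) ⟩
  c′ δ * st δ + rest c′ + c δ * st δ ≡⟨ cong (_+ c δ * st δ) (∑-rotate δ (term c′)) ⟨
  position st c′ + c δ * st δ        ∎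
  where
  open ≡-Reasoning
  term : (Dir → ℕ) → Dir → ℕ
  term c δ′ = c δ′ * st δ′
  rest : (Dir → ℕ) → ℕ
  rest c = term c (next δ) + term c (prev δ)
  rest-agrees : rest c ≡ rest c′
  rest-agrees = cong₂ (λ u v → u * st (next δ) + v * st (prev δ))
                      (c≈c′ _ (next≢ δ)) (c≈c′ _ (prev≢ δ))
  swap-outer : ∀ a r b → a + r + b ≡ b + r + a
  swap-outer = ℕ-Solver.solve-∀

-- In the application, T δ c ("c has type δ") says that b is constant along the δ-line through
-- the grid point c, and F l c that A ∩ Λ(a(c), D) is fibered in direction l.
module PlaneArgument {X : Set} (T F : Dir → (Dir → X) → Set)
  (T-along : ∀ {δ c c′} → c ≈[ δ ] c′ → T δ c → T δ c′)
  (F⇒T : ∀ {δ c} → F δ c → T δ c)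
  (F-plane : ∀ {l μ c c₁ c₂} → F l c → T μ c → c ≈[ μ ] c₁ → c₁ ≈[ l ] c₂ → T l c₂ × T μ c₂)
  (F-somewhere : ∀ c → ∃[ l ] F l c)
  (no-triple : ∀ c → ¬ (∀ δ → T δ c))
  where

  module _ (seed : ∀ δ → ∃[ c ] T δ c) where

    private
      C : Dir → Dir → X
      C δ = proj₁ (seed δ)

    F-excludes-other-types : ∀ {l μ c} → l ≢ μ → F l c → T μ c → ⊥
    F-excludes-other-types {l} {μ} {c} l≢μ Fl Tμ = no-triple x all-types
      where
      d = proj₁ (complement l≢μ)
      x = c [ μ ]≔ C d μ [ l ]≔ C d l
      in-plane : T l x × T μ x
      in-plane = F-plane Fl Tμ (≈-[]≔ c μ _) (≈-[]≔ _ l _)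
      on-seed-line : C d ≈[ d ] x
      on-seed-line δ δ≢d with proj₂ (complement l≢μ) δ
      ... | inj₁ refl        = sym ([]≔-updates _ l _)
      ... | inj₂ (inj₁ refl) = sym (trans ([]≔-minimal _ _ (l≢μ ∘ sym)) ([]≔-updates c μ _))
      ... | inj₂ (inj₂ δ≡d)  = contradiction δ≡d δ≢d
      all-types : ∀ δ → T δ x
      all-types δ with proj₂ (complement l≢μ) δ
      ... | inj₁ refl        = proj₁ in-plane
      ... | inj₂ (inj₁ refl) = proj₂ in-plane
      ... | inj₂ (inj₂ refl) = T-along on-seed-line (proj₂ (seed d))

    no-two-types : ∀ {a b c} → a ≢ b → T a c → T b c → ⊥
    no-two-types {a} {b} {c} a≢b Ta Tb with F-somewhere c
    ... | l , Fl with l ≟ a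
    ...   | yes refl = F-excludes-other-types a≢b Fl Tb
    ...   | no l≢a   = F-excludes-other-types l≢a Fl Ta

    -- R takes its δ-coordinate from the seed of direction prev δ, so whichever direction l is
    -- fibered at R, moving R along l lands on the (next l)-line through the seed of next l.
    seeds-incompatible : ⊥
    seeds-incompatible = no-two-types (next≢ l ∘ sym) (T-along (≈-[]≔ R l _) (F⇒T Fl)) Tnext
      where
      R : Dir → X
      R δ = C (prev δ) δ
      l = proj₁ (F-somewhere R)
      Fl = proj₂ (F-somewhere R)
      seed-line : ∀ m → C (next m) ≈[ next m ] R [ m ]≔ C (next m) m
      seed-line dᵢ dᵢ _   = refl
      seed-line dᵢ dⱼ j≢j = contradiction refl j≢j
      seed-line dᵢ dₖ _   = refl
      seed-line dⱼ dᵢ _   = refl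
      seed-line dⱼ dⱼ _   = refl
      seed-line dⱼ dₖ k≢k = contradiction refl k≢k
      seed-line dₖ dᵢ i≢i = contradiction refl i≢i
      seed-line dₖ dⱼ _   = refl
      seed-line dₖ dₖ _   = refl
      Tnext : T (next l) (R [ l ]≔ C (next l) l)
      Tnext = T-along (seed-line l) (proj₂ (seed (next l)))

injection-≤-∣∣ : ∀ {m n} (S : Subset m) {f : Fin n → Fin m} →
                 Injective _≡_ _≡_ f → (∀ t → f t ∈ S) → n ≤ ∣ S ∣
injection-≤-∣∣ {n = 0}     S f-injective f∈S = z≤n
injection-≤-∣∣ {n = suc n} S {f} f-injective f∈S =
  ℕP.≤-trans (s≤s (injection-≤-∣∣ (S - f zero) (FinP.suc-injective ∘ f-injective) f∘suc∈S-f₀))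
             (x∈p⇒∣p-x∣<∣p∣ (f∈S zero))
  where
  f∘suc∈S-f₀ : ∀ t → f (suc t) ∈ S - f zero
  f∘suc∈S-f₀ t = x∈p∧x≢y⇒x∈p-y (f∈S (suc t)) (FinP.0≢1+n ∘ sym ∘ f-injective)

injection-covers : ∀ {m n} (S : Subset m) {f : Fin n → Fin m} → Injective _≡_ _≡_ f → (∀ t → f t ∈ S) →
                   ∣ S ∣ ≡ n → ∀ {x} → x ∈ S → ∃[ t ] f t ≡ x
injection-covers S {f} f-injective f∈S |S|≡n {x} x∈S with FinP.any? (λ t → f t FinP.≟ x)
... | yes hit = hit
... | no miss = contradiction (injection-≤-∣∣ (S - x) f-injective f∈S-x)
                              (ℕP.<⇒≱ (subst (_ <_) |S|≡n (x∈p⇒∣p-x∣<∣p∣ x∈S)))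
  where
  f∈S-x : ∀ t → f t ∈ S - x
  f∈S-x t = x∈p∧x≢y⇒x∈p-y (f∈S t) (miss ∘ (t ,_))

remQuot-injective : ∀ {n} k {t t′ : Fin (n * k)} → remQuot {n} k t ≡ remQuot k t′ → t ≡ t′
remQuot-injective {n} k {t} {t′} eq =
  trans (sym (combine-remQuot {n} k t)) (trans (cong (λ (u , v) → combine u v) eq) (combine-remQuot {n} k t′))

box : (p : Dir → ℕ) → Fin (∏ p) → Dir → ℕ
box p t dᵢ = toℕ (proj₁ (remQuot {p dᵢ} (p dⱼ) (proj₁ (remQuot {p dᵢ * p dⱼ} (p dₖ) t))))
box p t dⱼ = toℕ (proj₂ (remQuot {p dᵢ} (p dⱼ) (proj₁ (remQuot {p dᵢ * p dⱼ} (p dₖ) t))))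
box p t dₖ = toℕ (proj₂ (remQuot {p dᵢ * p dⱼ} (p dₖ) t))

box-< : ∀ p t δ → box p t δ < p δ
box-< p t dᵢ = toℕ<n _
box-< p t dⱼ = toℕ<n _
box-< p t dₖ = toℕ<n _

box-injective : ∀ p {t t′} → (∀ δ → box p t δ ≡ box p t′ δ) → t ≡ t′
box-injective p same = remQuot-injective {p dᵢ * p dⱼ} (p dₖ) (cong₂ _,_
  (remQuot-injective {p dᵢ} (p dⱼ) (cong₂ _,_ (toℕ-injective (same dᵢ)) (toℕ-injective (same dⱼ))))
  (toℕ-injective (same dₖ)))

module Residues (M : ℕ) .{{_ : NonZero M}} where

  infixl 6 _⊕_

  _⊕_ : Fin M → ℕ → Fin M
  x ⊕ n = (toℕ x + n) mod M

  toℕ-mod : ∀ n → toℕ (n mod M) ≡ n [mod M ]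
  toℕ-mod n rewrite toℕ-fromℕ< (m%n<n n M) =
    subst (λ m → n % M ≡ m [mod M ]) (sym (m≡m%n+[m/n]*n n M)) (≡mod-sym (+-∣-≡mod (n % M) (n∣m*n (n / M))))

  toℕ-≡mod-injective : ∀ {x y : Fin M} → toℕ x ≡ toℕ y [mod M ] → x ≡ y
  toℕ-≡mod-injective {x} {y} = toℕ-injective ∘ ≡mod⇒≡ (toℕ<n x) (toℕ<n y)

  ⊕-≡mod : ∀ x n → toℕ (x ⊕ n) ≡ toℕ x + n [mod M ]
  ⊕-≡mod x n = toℕ-mod (toℕ x + n)

  ⊕-cong : ∀ x {m n} → m ≡ n [mod M ] → x ⊕ m ≡ x ⊕ n
  ⊕-cong x m≡n = toℕ-≡mod-injective
    (≡mod-trans (⊕-≡mod x _) (≡mod-trans (≡mod-+ ≡mod-refl m≡n) (≡mod-sym (⊕-≡mod x _))))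

  mod-⊕ : ∀ m n → m mod M ⊕ n ≡ (m + n) mod M
  mod-⊕ m n = toℕ-≡mod-injective
    (≡mod-trans (⊕-≡mod _ n) (≡mod-trans (≡mod-+ (toℕ-mod m) ≡mod-refl) (≡mod-sym (toℕ-mod (m + n)))))

  ⊕-assoc : ∀ x m n → x ⊕ m ⊕ n ≡ x ⊕ (m + n)
  ⊕-assoc x m n = trans (mod-⊕ (toℕ x + m) n) (cong (_mod M) (ℕP.+-assoc (toℕ x) m n))

  ⊕-identityʳ : ∀ x → x ⊕ 0 ≡ x
  ⊕-identityʳ x = toℕ-≡mod-injective
    (subst (λ m → toℕ (x ⊕ 0) ≡ m [mod M ]) (ℕP.+-identityʳ (toℕ x)) (⊕-≡mod x 0))

  ⊕-period : ∀ x {n} → M ∣ n → x ⊕ n ≡ x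
  ⊕-period x M∣n = trans (⊕-cong x (∣⇒≡mod0 M∣n)) (⊕-identityʳ x)

  ⊕-comm : ∀ x m n → x ⊕ m ⊕ n ≡ x ⊕ n ⊕ m
  ⊕-comm x m n = trans (⊕-assoc x m n) (trans (cong (x ⊕_) (ℕP.+-comm m n)) (sym (⊕-assoc x n m)))

  SameFiber : ℕ → Fin M → Fin M → Set
  SameFiber s x y = ∃[ k ] x ⊕ k * s ≡ y

  module _ {s : ℕ} where

    SameFiber-trans : ∀ {x y z} → SameFiber s x y → SameFiber s y z → SameFiber s x z
    SameFiber-trans {x} (k , refl) (k′ , refl) =
      k + k′ , trans (cong (x ⊕_) (ℕP.*-distribʳ-+ s k k′)) (sym (⊕-assoc x (k * s) (k′ * s)))

    -- A full turn: k·s + k·(M − 1)·s = (k·s)·M.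
    SameFiber-sym : ∀ {x y} → SameFiber s x y → SameFiber s y x
    SameFiber-sym {x} (k , refl) = k * pred M , trans (⊕-assoc x (k * s) _) (⊕-period x (divides (k * s) full-cycle))
      where
      full-cycle : k * s + k * pred M * s ≡ k * s * M
      full-cycle = trans (split k s (pred M)) (cong (k * s *_) (ℕP.suc-pred M))
        where
        split : ∀ k s m → k * s + k * m * s ≡ k * s * suc m
        split = ℕ-Solver.solve-∀

    SameFiber-≡mod : ∀ {d x y} → d ∣ s → d ∣ M → SameFiber s x y → toℕ x ≡ toℕ y [mod d ]
    SameFiber-≡mod {d} {x} d∣s d∣M (k , refl) =
      ≡mod-trans (≡mod-sym (+-∣-≡mod (toℕ x) (∣n⇒∣m*n k d∣s)))
                 (≡mod-∣ d∣M (≡mod-sym (⊕-≡mod x (k * s))))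

    InFiber⇒SameFiber : ∀ {p x y} → InFiber M s p x y → SameFiber s x y
    InFiber⇒SameFiber {x = x} (t , _ , x+ts≡y) =
      t , toℕ-≡mod-injective (≡mod-trans (⊕-≡mod x (t * s)) (ModEq⇒≡mod x+ts≡y))

    SameFiber⇒InFiber : ∀ {p x y} .{{_ : NonZero p}} → p * s ≡ M → SameFiber s x y → InFiber M s p x y
    SameFiber⇒InFiber {p} {x} p*s≡M (k , refl) =
      k % p , m%n<n k p ,
      ≡mod⇒ModEq (subst (λ z → toℕ x + k % p * s ≡ toℕ z [mod M ]) reduce (≡mod-sym (⊕-≡mod x _)))
      where
      open ≡-Reasoning
      distribute : ∀ r q p s → (r + q * p) * s ≡ r * s + q * (p * s)
      distribute = ℕ-Solver.solve-∀
      k*s≡ : k * s ≡ k % p * s + k / p * M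
      k*s≡ = begin
        k * s                        ≡⟨ cong (_* s) (m≡m%n+[m/n]*n k p) ⟩
        (k % p + k / p * p) * s      ≡⟨ distribute (k % p) (k / p) p s ⟩
        k % p * s + k / p * (p * s)  ≡⟨ cong (λ n → k % p * s + k / p * n) p*s≡M ⟩
        k % p * s + k / p * M        ∎
      reduce : x ⊕ k % p * s ≡ x ⊕ k * s
      reduce = ⊕-cong x (≡mod-sym (subst (_≡ k % p * s [mod M ]) (sym k*s≡) (+-∣-≡mod _ (n∣m*n (k / p)))))

  SameFiber-swap : ∀ {s s′ x y z} → SameFiber s x y → SameFiber s′ y z →
                   ∃[ w ] SameFiber s′ x w × SameFiber s w z
  SameFiber-swap {s} {s′} {x} (k , refl) (k′ , refl) =
    x ⊕ k′ * s′ , (k′ , refl) , (k , ⊕-comm x (k′ * s′) (k * s))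

  module _ {s p : ℕ} .{{_ : NonZero p}} (p*s≡M : p * s ≡ M) {S : Fin M → Set} {x : Fin M} where

    FiberIn⇒ : FiberIn M s p S x → ∀ {y} → SameFiber s x y → S y
    FiberIn⇒ fiber⊆S x∼y = fiber⊆S _ (SameFiber⇒InFiber p*s≡M x∼y)

    ⇒FiberIn : (∀ {y} → SameFiber s x y → S y) → FiberIn M s p S x
    ⇒FiberIn fiber⊆S y = fiber⊆S ∘ InFiber⇒SameFiber

  FiberIn? : ∀ {S : Fin M → Set} → (∀ x → Dec (S x)) → ∀ s p x → Dec (FiberIn M s p S x)
  FiberIn? {S} S? s p x = map′ enumerated⇒ ⇒enumerated (FinP.all? λ t → S? (x ⊕ toℕ t * s))
    where
    enumerated⇒ : (∀ (t : Fin p) → S (x ⊕ toℕ t * s)) → FiberIn M s p S x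
    enumerated⇒ S-at y (t , t<p , x+ts≡y) =
      subst S (trans (cong (λ u → x ⊕ u * s) (toℕ-fromℕ< t<p)) (proj₂ (InFiber⇒SameFiber (t , t<p , x+ts≡y))))
        (S-at (fromℕ< t<p))
    ⇒enumerated : FiberIn M s p S x → ∀ (t : Fin p) → S (x ⊕ toℕ t * s)
    ⇒enumerated fiber⊆S t = fiber⊆S _ (toℕ t , toℕ<n t , ≡mod⇒ModEq (≡mod-sym (⊕-≡mod x _)))

  module Decomposition {A B : Subset M} (tiling : Tiling M A B) where

    aPart bPart : Fin M → Fin M
    aPart x = proj₁ (tiling x)
    bPart x = proj₁ (proj₂ (tiling x))

    private
      decomposition : ∀ x → IsSumOf M A B x (aPart x) (bPart x)
      decomposition x = proj₁ (proj₂ (proj₂ (tiling x)))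

    aPart∈A : ∀ x → aPart x ∈ A
    aPart∈A x = proj₁ (decomposition x)

    bPart∈B : ∀ x → bPart x ∈ B
    bPart∈B x = proj₁ (proj₂ (decomposition x))

    aPart+bPart : ∀ x → toℕ (aPart x) + toℕ (bPart x) ≡ toℕ x [mod M ]
    aPart+bPart x = ModEq⇒≡mod (proj₂ (proj₂ (decomposition x)))

    decomposition-unique : ∀ {x a b} → a ∈ A → b ∈ B → toℕ a + toℕ b ≡ toℕ x [mod M ] →
                           a ≡ aPart x × b ≡ bPart x
    decomposition-unique {x} a∈A b∈B a+b≡x =
      proj₂ (proj₂ (proj₂ (tiling x))) _ _ (a∈A , b∈B , ≡mod⇒ModEq a+b≡x)

    ⊕-decomposition : ∀ x n → toℕ (aPart x ⊕ n) + toℕ (bPart x) ≡ toℕ (x ⊕ n) [mod M ]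
    ⊕-decomposition x n = begin
      toℕ (aPart x ⊕ n) + toℕ (bPart x) ≈⟨ ≡mod-+ (⊕-≡mod (aPart x) n) ≡mod-refl ⟩
      toℕ (aPart x) + n + toℕ (bPart x) ≡⟨ right-comm (toℕ (aPart x)) n _ ⟩
      toℕ (aPart x) + toℕ (bPart x) + n ≈⟨ ≡mod-+ (aPart+bPart x) ≡mod-refl ⟩
      toℕ x + n                         ≈⟨ ≡mod-sym (⊕-≡mod x n) ⟩
      toℕ (x ⊕ n)                       ∎
      where
      open SetoidReasoning ≡mod-setoid
      right-comm : ∀ a n b → a + n + b ≡ a + b + n
      right-comm = ℕ-Solver.solve-∀

    bPart-⊕ : ∀ x n → aPart x ⊕ n ∈ A → bPart (x ⊕ n) ≡ bPart x
    bPart-⊕ x n shifted∈A = sym (proj₂ (decomposition-unique shifted∈A (bPart∈B x) (⊕-decomposition x n)))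

    aPart-⊕ : ∀ x n → bPart (x ⊕ n) ≡ bPart x → aPart (x ⊕ n) ≡ aPart x ⊕ n
    aPart-⊕ x n same-b = toℕ-≡mod-injective (≡mod-+-cancelʳ (toℕ (bPart x))
      (≡mod-trans (subst (λ b → toℕ (aPart (x ⊕ n)) + toℕ b ≡ _ [mod M ]) same-b (aPart+bPart (x ⊕ n)))
                  (≡mod-sym (⊕-decomposition x n))))

    module _ {d : ℕ} (d∣M : d ∣ M) where

      parts-≡mod : ∀ {x y} → toℕ x ≡ toℕ y [mod d ] →
                   toℕ (aPart x) + toℕ (bPart x) ≡ toℕ (aPart y) + toℕ (bPart y) [mod d ]
      parts-≡mod {x} {y} x≡y =
        ≡mod-trans (≡mod-∣ d∣M (aPart+bPart x)) (≡mod-trans x≡y (≡mod-sym (≡mod-∣ d∣M (aPart+bPart y))))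

      aPart-≡mod : ∀ {x y} → bPart x ≡ bPart y → toℕ x ≡ toℕ y [mod d ] →
                   toℕ (aPart x) ≡ toℕ (aPart y) [mod d ]
      aPart-≡mod {x} {y} same-b x≡y = ≡mod-+-cancelʳ (toℕ (bPart y))
        (subst (λ b → toℕ (aPart x) + toℕ b ≡ toℕ (aPart y) + toℕ (bPart y) [mod d ]) same-b
          (parts-≡mod x≡y))

      aPart-injective-mod : (∀ {b b′} → b ∈ B → b′ ∈ B → toℕ b ≡ toℕ b′ [mod d ] → b ≡ b′) →
                            ∀ {x y} → toℕ x ≡ toℕ y [mod d ] → aPart x ≡ aPart y → x ≡ y
      aPart-injective-mod B-incongruent {x} {y} x≡y same-a = toℕ-≡mod-injective
        (≡mod-trans (≡mod-sym (aPart+bPart x))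
          (subst₂ (λ a b → toℕ a + toℕ b ≡ toℕ y [mod M ]) (sym same-a) (sym same-b) (aPart+bPart y)))
        where
        same-b : bPart x ≡ bPart y
        same-b = B-incongruent (bPart∈B x) (bPart∈B y) (≡mod-+-cancelˡ (toℕ (aPart y))
          (subst (λ a → toℕ a + toℕ (bPart x) ≡ toℕ (aPart y) + toℕ (bPart y) [mod d ]) same-a
            (parts-≡mod x≡y)))

module Geometry
  {M : ℕ} .{{_ : NonZero M}} {D : ℕ} {p st : Dir → ℕ}
  (p*st≡M : ∀ δ → p δ * st δ ≡ M)
  (D∣st : ∀ δ → D ∣ st δ)
  (coordinate-determined : ∀ c c′ δ → position st c ≡ position st c′ [mod M ] → c δ ≡ c′ δ [mod p δ ])
  {A B : Subset M} (tiling : Tiling M A B)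
  (B-incongruent : ∀ {b b′} → b ∈ B → b′ ∈ B → toℕ b ≡ toℕ b′ [mod D ] → b ≡ b′)
  where

  open Residues M
  open Decomposition tiling

  p-nonZero : ∀ δ → NonZero (p δ)
  p-nonZero δ = ≢-nonZero λ p≡0 → ≢-nonZero⁻¹ M (trans (sym (p*st≡M δ)) (cong (_* st δ) p≡0))

  D∣M : D ∣ M
  D∣M = subst (D ∣_) (p*st≡M dᵢ) (∣n⇒∣m*n (p dᵢ) (D∣st dᵢ))

  BConstAlong : Dir → Fin M → Set
  BConstAlong δ x = ∀ {y} → SameFiber (st δ) x y → bPart y ≡ bPart x

  ΛFibered : Dir → Fin M → Set
  ΛFibered δ x = ∀ {y} → toℕ x ≡ toℕ y [mod D ] → bPart y ≡ bPart x → BConstAlong δ y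

  module _ {δ : Dir} where

    private instance
      _ = p-nonZero δ

    FibPart⇒BConstAlong : ∀ {x} → FibPart M (st δ) (p δ) A (aPart x) → BConstAlong δ x
    FibPart⇒BConstAlong {x} (_ , fiber⊆A) (k , refl) =
      bPart-⊕ x (k * st δ) (FiberIn⇒ (p*st≡M δ) fiber⊆A (k , refl))

    BConstAlong⇒FibPart : ∀ {x} → BConstAlong δ x → FibPart M (st δ) (p δ) A (aPart x)
    BConstAlong⇒FibPart {x} b-const = aPart∈A x , ⇒FiberIn (p*st≡M δ) λ where
      (k , refl) → subst (_∈ A) (aPart-⊕ x (k * st δ) (b-const (k , refl))) (aPart∈A _)

    Fibered⇒ΛFibered : ∀ {x} → Fibered M (st δ) (p δ) (AΛ M D A (aPart x)) → ΛFibered δ x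
    Fibered⇒ΛFibered {x} fibered {y} x≡y same-b (k , refl) =
      bPart-⊕ y (k * st δ) (proj₁ (FiberIn⇒ (p*st≡M δ) (fibered (aPart y) (aPart∈A y , Λ-ay)) (k , refl)))
      where
      Λ-ay : Λ M D (aPart x) (aPart y)
      Λ-ay = ≡mod⇒ModEq (aPart-≡mod D∣M (sym same-b) x≡y)

    ΛFibered⇒BConstAlong : ∀ {x} → ΛFibered δ x → BConstAlong δ x
    ΛFibered⇒BConstAlong Λ-fibered = Λ-fibered ≡mod-refl refl

    BConstAlong-fiber : ∀ {x y} → BConstAlong δ x → SameFiber (st δ) x y → BConstAlong δ y
    BConstAlong-fiber b-const x∼y y∼z = trans (b-const (SameFiber-trans x∼y y∼z)) (sym (b-const x∼y))

  InPlane : Dir → Dir → Fin M → Fin M → Set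
  InPlane l μ x z = ∃[ y ] SameFiber (st μ) x y × SameFiber (st l) y z

  module _ {l μ : Dir} {x : Fin M} where

    InPlane-along-l : ∀ {z w} → InPlane l μ x z → SameFiber (st l) z w → InPlane l μ x w
    InPlane-along-l (y , x∼y , y∼z) z∼w = y , x∼y , SameFiber-trans y∼z z∼w

    InPlane-along-μ : ∀ {z w} → InPlane l μ x z → SameFiber (st μ) z w → InPlane l μ x w
    InPlane-along-μ (y , x∼y , y∼z) z∼w with SameFiber-swap y∼z z∼w
    ... | y′ , y∼y′ , y′∼w = y′ , SameFiber-trans x∼y y∼y′ , y′∼w

    ΛFibered-plane : ΛFibered l x → BConstAlong μ x → ∀ {z} → InPlane l μ x z → bPart z ≡ bPart x
    ΛFibered-plane Λ-fibered b-const (y , x∼y , y∼z) =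
      trans (Λ-fibered (SameFiber-≡mod (D∣st μ) D∣M x∼y) (b-const x∼y) y∼z) (b-const x∼y)

    ΛFibered-spreads : ΛFibered l x → BConstAlong μ x →
                       ∀ {z} → InPlane l μ x z → BConstAlong l z × BConstAlong μ z
    ΛFibered-spreads Λ-fibered b-const z∈ =
      (λ z∼w → trans (plane (InPlane-along-l z∈ z∼w)) (sym (plane z∈))) ,
      (λ z∼w → trans (plane (InPlane-along-μ z∈ z∼w)) (sym (plane z∈)))
      where
      plane = ΛFibered-plane Λ-fibered b-const

  point : (Dir → ℕ) → Fin M
  point c = position st c mod M

  point-≈ : ∀ {c c′ δ} → c ≈[ δ ] c′ → SameFiber (st δ) (point c) (point c′)
  point-≈ {c} {c′} {δ} c≈c′ = SameFiber-trans (c′ δ , meet) (SameFiber-sym (c δ , refl))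
    where
    meet : point c ⊕ c′ δ * st δ ≡ point c′ ⊕ c δ * st δ
    meet = trans (mod-⊕ _ _) (trans (cong (_mod M) (position-≈ st c≈c′)) (sym (mod-⊕ _ _)))

  point-≡mod-D : ∀ c c′ → toℕ (point c) ≡ toℕ (point c′) [mod D ]
  point-≡mod-D c c′ = ≡mod-trans (≡0 c) (≡mod-sym (≡0 c′))
    where
    ≡0 : ∀ c → toℕ (point c) ≡ 0 [mod D ]
    ≡0 c = ≡mod-trans (≡mod-∣ D∣M (toℕ-mod _)) (∣⇒≡mod0 (∑-∣ λ δ → ∣n⇒∣m*n (c δ) (D∣st δ)))

  point-injective : ∀ {c c′} → (∀ δ → c δ < p δ) → (∀ δ → c′ δ < p δ) →
                    point c ≡ point c′ → ∀ δ → c δ ≡ c′ δ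
  point-injective {c} {c′} c<p c′<p same δ = ≡mod⇒≡ (c<p δ) (c′<p δ) (coordinate-determined c c′ δ
    (≡mod-trans (≡mod-sym (toℕ-mod _)) (subst (λ z → toℕ z ≡ position st c′ [mod M ]) (sym same) (toℕ-mod _))))

  grid-injective : Injective _≡_ _≡_ (aPart ∘ point ∘ box p)
  grid-injective {t} {t′} same =
    box-injective p {t} {t′} (point-injective {box p t} {box p t′} (box-< p t) (box-< p t′) same-point)
    where
    same-point : point (box p t) ≡ point (box p t′)
    same-point = aPart-injective-mod D∣M B-incongruent {point (box p t)} {point (box p t′)}
                   (point-≡mod-D (box p t) (box p t′)) same

  A-covered : ∣ A ∣ ≡ ∏ p → ∀ {a} → a ∈ A → ∃[ c ] aPart (point c) ≡ a
  A-covered |A| {a} a∈A = box p (proj₁ covered) , proj₂ covered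
    where
    covered : ∃[ t ] aPart (point (box p t)) ≡ a
    covered = injection-covers A grid-injective (λ t → aPart∈A (point (box p t))) |A| a∈A

  GridBConst : Dir → (Dir → ℕ) → Set
  GridBConst δ c = BConstAlong δ (point c)

  GridΛFibered : Dir → (Dir → ℕ) → Set
  GridΛFibered δ c = ΛFibered δ (point c)

  GridBConst-along : ∀ {δ c c′} → c ≈[ δ ] c′ → GridBConst δ c → GridBConst δ c′
  GridBConst-along c≈c′ b-const = BConstAlong-fiber b-const (point-≈ c≈c′)

  GridΛFibered-spreads : ∀ {l μ c c₁ c₂} → GridΛFibered l c → GridBConst μ c →
                         c ≈[ μ ] c₁ → c₁ ≈[ l ] c₂ → GridBConst l c₂ × GridBConst μ c₂
  GridΛFibered-spreads {c₁ = c₁} Λ-fibered b-const c≈c₁ c₁≈c₂ =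
    ΛFibered-spreads Λ-fibered b-const (point c₁ , point-≈ c≈c₁ , point-≈ c₁≈c₂)

  GridΛFibered-somewhere : (∀ a → a ∈ A → ∃[ δ ] Fibered M (st δ) (p δ) (AΛ M D A a)) →
                           ∀ c → ∃[ δ ] GridΛFibered δ c
  GridΛFibered-somewhere fibered c =
    map₂ (Fibered⇒ΛFibered {x = point c}) (fibered (aPart (point c)) (aPart∈A (point c)))

  ¬all-GridBConst : (∀ a → ¬ (∀ δ → FibPart M (st δ) (p δ) A a)) → ∀ c → ¬ (∀ δ → GridBConst δ c)
  ¬all-GridBConst no-triple c all =
    no-triple (aPart (point c)) (λ δ → BConstAlong⇒FibPart {δ} {point c} (all δ))

  GridBConst-seed : ∣ A ∣ ≡ ∏ p → ∀ {δ a} → FibPart M (st δ) (p δ) A a → ∃[ c ] GridBConst δ c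
  GridBConst-seed |A| {δ} {a} a∈I = proj₁ covered , FibPart⇒BConstAlong {δ} {point (proj₁ covered)} a∈I′
    where
    covered : ∃[ c ] aPart (point c) ≡ a
    covered = A-covered |A| (proj₁ a∈I)
    a∈I′ : FibPart M (st δ) (p δ) A (aPart (point (proj₁ covered)))
    a∈I′ = subst (FibPart M (st δ) (p δ) A) (sym (proj₂ covered)) a∈I

  FibPart-nonempty? : ∀ δ → Dec (∃[ a ] FibPart M (st δ) (p δ) A a)
  FibPart-nonempty? δ = FinP.any? λ a → (a ∈? A) ×-dec FiberIn? (_∈? A) (st δ) (p δ) a

  some-direction-empty :
    (∀ a → a ∈ A → ∃[ δ ] Fibered M (st δ) (p δ) (AΛ M D A a)) →
    (∀ a → ¬ (∀ δ → FibPart M (st δ) (p δ) A a)) →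
    ∣ A ∣ ≡ ∏ p →
    ∃[ δ ] ∀ a → ¬ FibPart M (st δ) (p δ) A a
  some-direction-empty fibered no-triple |A| = map₂ curry $
    ¬∀⇒∃¬ FibPart-nonempty? λ nonempty → seeds-incompatible λ δ → GridBConst-seed |A| (proj₂ (nonempty δ))
    where
    open PlaneArgument GridBConst GridΛFibered GridBConst-along ΛFibered⇒BConstAlong GridΛFibered-spreads
      (GridΛFibered-somewhere fibered) (¬all-GridBConst no-triple)

Div-avoids-multiples⇒incongruent : ∀ {M D} {B : Subset M} → D ∣ M →
  (∀ m → (D ∣ m) × (m ∣ M) × InDiv M B m → m ≡ M) →
  ∀ {b b′} → b ∈ B → b′ ∈ B → toℕ b ≡ toℕ b′ [mod D ] → b ≡ b′
Div-avoids-multiples⇒incongruent {M} {D} D∣M only-M {b} {b′} b∈B b′∈B b≡b′ =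
  toℕ-injective (≡mod⇒≡ (toℕ<n b) (toℕ<n b′) (≡mod (∣ᵤ⇒∣ M∣b-b′)))
  where
  |b-b′| = ℤ.∣ + toℕ b ℤ.- + toℕ b′ ∣
  g≡M : gcd |b-b′| M ≡ M
  g≡M = only-M (gcd |b-b′| M)
    (gcd-greatest {|b-b′|} {M} (≡mod⇒ModEq b≡b′) D∣M , gcd[m,n]∣n |b-b′| M , b , b′ , b∈B , b′∈B , refl)
  M∣b-b′ : M ∣ |b-b′|
  M∣b-b′ = subst (_∣ |b-b′|) g≡M (gcd[m,n]∣m |b-b′| M)

prime∣prime⇒≡ : ∀ {p q} → Prime p → Prime q → p ∣ q → p ≡ q
prime∣prime⇒≡ p-prime q-prime p∣q with prime⇒irreducible q-prime p∣q
... | inj₁ refl = contradiction p-prime ¬prime[1]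
... | inj₂ p≡q  = p≡q

-- M = ∏ p_δ ^ (n_δ + 1), so n δ is the paper's n_δ − 1, D is D(M) and st δ = M / p δ.
module PrimePowerModulus (p n : Dir → ℕ) (p-prime : ∀ δ → Prime (p δ))
  (p-distinct : ∀ {δ δ′} → δ ≢ δ′ → p δ ≢ p δ′) where

  M D : ℕ
  M = ∏ λ δ → p δ ^ suc (n δ)
  D = ∏ λ δ → p δ ^ n δ

  st cofactor : Dir → ℕ
  st dᵢ = p dᵢ ^ n dᵢ * p dⱼ ^ suc (n dⱼ) * p dₖ ^ suc (n dₖ)
  st dⱼ = p dᵢ ^ suc (n dᵢ) * p dⱼ ^ n dⱼ * p dₖ ^ suc (n dₖ)
  st dₖ = p dᵢ ^ suc (n dᵢ) * p dⱼ ^ suc (n dⱼ) * p dₖ ^ n dₖ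
  cofactor δ = p (next δ) * p (prev δ)

  power-nonZero : ∀ δ k → NonZero (p δ ^ k)
  power-nonZero δ k = ℕP.m^n≢0 (p δ) k {{prime⇒nonZero (p-prime δ)}}

  M-nonZero : NonZero M
  M-nonZero = ∏-nonZero λ δ → power-nonZero δ (suc (n δ))

  D-nonZero : NonZero D
  D-nonZero = ∏-nonZero λ δ → power-nonZero δ (n δ)

  p*st≡M : ∀ δ → p δ * st δ ≡ M
  p*st≡M dᵢ = reassociate (p dᵢ) (p dᵢ ^ n dᵢ) (p dⱼ ^ suc (n dⱼ)) (p dₖ ^ suc (n dₖ))
    where
    reassociate : ∀ a x y z → a * (x * y * z) ≡ a * x * y * z
    reassociate = ℕ-Solver.solve-∀
  p*st≡M dⱼ = reassociate (p dⱼ) (p dᵢ ^ suc (n dᵢ)) (p dⱼ ^ n dⱼ) (p dₖ ^ suc (n dₖ))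
    where
    reassociate : ∀ b x y z → b * (x * y * z) ≡ x * (b * y) * z
    reassociate = ℕ-Solver.solve-∀
  p*st≡M dₖ = reassociate (p dₖ) (p dᵢ ^ suc (n dᵢ)) (p dⱼ ^ suc (n dⱼ)) (p dₖ ^ n dₖ)
    where
    reassociate : ∀ c x y z → c * (x * y * z) ≡ x * y * (c * z)
    reassociate = ℕ-Solver.solve-∀

  st≡cofactor*D : ∀ δ → st δ ≡ cofactor δ * D
  st≡cofactor*D dᵢ = regroup (p dᵢ ^ n dᵢ) (p dⱼ) (p dⱼ ^ n dⱼ) (p dₖ) (p dₖ ^ n dₖ)
    where
    regroup : ∀ x b y c z → x * (b * y) * (c * z) ≡ b * c * (x * y * z)
    regroup = ℕ-Solver.solve-∀
  st≡cofactor*D dⱼ = regroup (p dᵢ) (p dᵢ ^ n dᵢ) (p dⱼ ^ n dⱼ) (p dₖ) (p dₖ ^ n dₖ)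
    where
    regroup : ∀ a x y c z → a * x * y * (c * z) ≡ c * a * (x * y * z)
    regroup = ℕ-Solver.solve-∀
  st≡cofactor*D dₖ = regroup (p dᵢ) (p dᵢ ^ n dᵢ) (p dⱼ) (p dⱼ ^ n dⱼ) (p dₖ ^ n dₖ)
    where
    regroup : ∀ a x b y z → a * x * (b * y) * z ≡ a * b * (x * y * z)
    regroup = ℕ-Solver.solve-∀

  p∣cofactor : ∀ {δ δ′} → δ′ ≢ δ → p δ ∣ cofactor δ′
  p∣cofactor {dᵢ} {dᵢ} i≢i = contradiction refl i≢i
  p∣cofactor {dᵢ} {dⱼ} _   = n∣m*n (p dₖ)
  p∣cofactor {dᵢ} {dₖ} _   = m∣m*n (p dⱼ)
  p∣cofactor {dⱼ} {dᵢ} _   = m∣m*n (p dₖ)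
  p∣cofactor {dⱼ} {dⱼ} j≢j = contradiction refl j≢j
  p∣cofactor {dⱼ} {dₖ} _   = n∣m*n (p dᵢ)
  p∣cofactor {dₖ} {dᵢ} _   = n∣m*n (p dⱼ)
  p∣cofactor {dₖ} {dⱼ} _   = m∣m*n (p dᵢ)
  p∣cofactor {dₖ} {dₖ} k≢k = contradiction refl k≢k

  p∤cofactor : ∀ δ → ¬ p δ ∣ cofactor δ
  p∤cofactor δ p∣cofactor with euclidsLemma _ _ (p-prime δ) p∣cofactor
  ... | inj₁ p∣p-next = p-distinct (next≢ δ ∘ sym) (prime∣prime⇒≡ (p-prime δ) (p-prime (next δ)) p∣p-next)
  ... | inj₂ p∣p-prev = p-distinct (prev≢ δ ∘ sym) (prime∣prime⇒≡ (p-prime δ) (p-prime (prev δ)) p∣p-prev)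

  D∣st : ∀ δ → D ∣ st δ
  D∣st δ = divides (cofactor δ) (st≡cofactor*D δ)

  pD∣M : ∀ δ → p δ * D ∣ M
  pD∣M δ = divides (cofactor δ) (begin
    M                        ≡⟨ p*st≡M δ ⟨
    p δ * st δ               ≡⟨ cong (p δ *_) (st≡cofactor*D δ) ⟩
    p δ * (cofactor δ * D)   ≡⟨ shuffle (p δ) (cofactor δ) D ⟩
    cofactor δ * (p δ * D)   ∎)
    where
    open ≡-Reasoning
    shuffle : ∀ a e d → a * (e * d) ≡ e * (a * d)
    shuffle = ℕ-Solver.solve-∀

  D∣M : D ∣ M
  D∣M = ℕ∣.∣-trans (n∣m*n (p dᵢ)) (pD∣M dᵢ)

  position-≡mod : ∀ c δ → position st c ≡ c δ * cofactor δ * D [mod p δ * D ]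
  position-≡mod c δ = begin
    position st c                             ≡⟨ ∑-rotate δ (λ δ′ → c δ′ * st δ′) ⟩
    c δ * st δ + rest                          ≈⟨ +-∣-≡mod (c δ * st δ) pD∣rest ⟩
    c δ * st δ                                 ≡⟨ cong (c δ *_) (st≡cofactor*D δ) ⟩
    c δ * (cofactor δ * D)                     ≡⟨ ℕP.*-assoc (c δ) (cofactor δ) D ⟨
    c δ * cofactor δ * D                       ∎
    where
    open SetoidReasoning ≡mod-setoid
    rest = c (next δ) * st (next δ) + c (prev δ) * st (prev δ)
    pD∣term : ∀ {δ′} → δ′ ≢ δ → p δ * D ∣ c δ′ * st δ′
    pD∣term {δ′} δ′≢δ =
      ∣n⇒∣m*n (c δ′) (subst (p δ * D ∣_) (sym (st≡cofactor*D δ′)) (ℕ∣.*-monoˡ-∣ D (p∣cofactor δ′≢δ)))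
    pD∣rest : p δ * D ∣ rest
    pD∣rest = ∣m∣n⇒∣m+n (pD∣term (next≢ δ)) (pD∣term (prev≢ δ))

  coordinate-determined : ∀ c c′ δ → position st c ≡ position st c′ [mod M ] → c δ ≡ c′ δ [mod p δ ]
  coordinate-determined c c′ δ same-position = prime-*-cancelʳ-≡mod (p-prime δ) (p∤cofactor δ)
    (*-cancelʳ-≡mod D {{D-nonZero}} (≡mod-trans (≡mod-sym (position-≡mod c δ))
      (≡mod-trans (≡mod-∣ (pD∣M δ) same-position) (position-≡mod c′ δ))))

corollary12p2 :
    (pi pj pk ni nj nk : ℕ) →
    Prime pi → Prime pj → Prime pk →
    ¬ pi ≡ pj → ¬ pi ≡ pk → ¬ pj ≡ pk →
    1 ≤ ni → 1 ≤ nj → 1 ≤ nk →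
    (A B : Subset (pi ^ ni * pj ^ nj * pk ^ nk)) →
    Tiling (pi ^ ni * pj ^ nj * pk ^ nk) A B →
    ∣ A ∣ ≡ pi * pj * pk →
    PhiDivides pi pj pk ni nj nk (mask A) →
    (∀ a → a ∈ A →
      Fibered (pi ^ ni * pj ^ nj * pk ^ nk) (pi ^ (ni ∸ 1) * pj ^ nj * pk ^ nk) pi
        (AΛ (pi ^ ni * pj ^ nj * pk ^ nk) (pi ^ (ni ∸ 1) * pj ^ (nj ∸ 1) * pk ^ (nk ∸ 1)) A a)
      ⊎ (Fibered (pi ^ ni * pj ^ nj * pk ^ nk) (pi ^ ni * pj ^ (nj ∸ 1) * pk ^ nk) pj
        (AΛ (pi ^ ni * pj ^ nj * pk ^ nk) (pi ^ (ni ∸ 1) * pj ^ (nj ∸ 1) * pk ^ (nk ∸ 1)) A a)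
      ⊎ Fibered (pi ^ ni * pj ^ nj * pk ^ nk) (pi ^ ni * pj ^ nj * pk ^ (nk ∸ 1)) pk
        (AΛ (pi ^ ni * pj ^ nj * pk ^ nk) (pi ^ (ni ∸ 1) * pj ^ (nj ∸ 1) * pk ^ (nk ∸ 1)) A a))) →
    (∀ a →
      FibPart (pi ^ ni * pj ^ nj * pk ^ nk) (pi ^ (ni ∸ 1) * pj ^ nj * pk ^ nk) pi A a →
      FibPart (pi ^ ni * pj ^ nj * pk ^ nk) (pi ^ ni * pj ^ (nj ∸ 1) * pk ^ nk) pj A a →
      FibPart (pi ^ ni * pj ^ nj * pk ^ nk) (pi ^ ni * pj ^ nj * pk ^ (nk ∸ 1)) pk A a → ⊥) →
    (∀ m →
      (((pi ^ (ni ∸ 1) * pj ^ (nj ∸ 1) * pk ^ (nk ∸ 1)) ∣ m) × (m ∣ (pi ^ ni * pj ^ nj * pk ^ nk))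
        × InDiv (pi ^ ni * pj ^ nj * pk ^ nk) B m
        → m ≡ pi ^ ni * pj ^ nj * pk ^ nk)
      × (m ≡ pi ^ ni * pj ^ nj * pk ^ nk →
        ((pi ^ (ni ∸ 1) * pj ^ (nj ∸ 1) * pk ^ (nk ∸ 1)) ∣ m) × (m ∣ (pi ^ ni * pj ^ nj * pk ^ nk))
          × InDiv (pi ^ ni * pj ^ nj * pk ^ nk) B m)) →
    (∀ (a : Fin (pi ^ ni * pj ^ nj * pk ^ nk)) →
        ¬ FibPart (pi ^ ni * pj ^ nj * pk ^ nk) (pi ^ (ni ∸ 1) * pj ^ nj * pk ^ nk) pi A a)
    ⊎ (∀ (a : Fin (pi ^ ni * pj ^ nj * pk ^ nk)) →
        ¬ FibPart (pi ^ ni * pj ^ nj * pk ^ nk) (pi ^ ni * pj ^ (nj ∸ 1) * pk ^ nk) pj A a)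
    ⊎ (∀ (a : Fin (pi ^ ni * pj ^ nj * pk ^ nk)) →
        ¬ FibPart (pi ^ ni * pj ^ nj * pk ^ nk) (pi ^ ni * pj ^ nj * pk ^ (nk ∸ 1)) pk A a)
corollary12p2 _ _ _ 0 _ _ _ _ _ _ _ _ () _ _ _ _ _ _ _ _ _ _
corollary12p2 _ _ _ (suc _) 0 _ _ _ _ _ _ _ _ () _ _ _ _ _ _ _ _ _
corollary12p2 _ _ _ (suc _) (suc _) 0 _ _ _ _ _ _ _ _ () _ _ _ _ _ _ _ _
corollary12p2 pi pj pk (suc ni) (suc nj) (suc nk) pi-prime pj-prime pk-prime pi≢pj pi≢pk pj≢pk _ _ _
              A B tiling |A| _ fibered no-triple Div-condition =
  ∃⇒⊎₃ (some-direction-empty (⊎₃⇒∃ ∘₂ fibered) I∩J∩K≡∅ |A|)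
  where
  open PrimePowerModulus ⟨ pi , pj , pk ⟩ ⟨ ni , nj , nk ⟩ (⟨,,⟩-all Prime pi-prime pj-prime pk-prime)
    (⟨,,⟩-distinct pi≢pj pi≢pk pj≢pk)
  open Geometry {{M-nonZero}} p*st≡M D∣st coordinate-determined tiling
    (Div-avoids-multiples⇒incongruent D∣M (λ m → proj₁ (Div-condition m)))
  I∩J∩K≡∅ : ∀ a → ¬ (∀ δ → FibPart M (st δ) (⟨ pi , pj , pk ⟩ δ) A a)
  I∩J∩K≡∅ a in-all = no-triple a (in-all dᵢ) (in-all dⱼ) (in-all dₖ)
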